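{- For $n\in\mathbb{N}$, we have $g_3(n)\le 2n$ if and only if $n\neq 4$.
   Context: $\mathbb{N}=\{0,1,2,\dots\}$. For an integer $m\ge 2$, an $m$-product sequence is a finite sequence of integers $a_1\le a_2\le\dots\le a_t$ such that $\prod_{i=1}^t a_i=R^m$ for some $R\in\mathbb{N}$ and no integer appears more than $m-1$ times in the sequence. For $n\in\mathbb{N}$, $g_m(n)$ is the least integer $s$ such that there exists an $m$-product sequence $a_1\le\dots\le a_t$ with $a_1=n$ and $a_t=s$. -}

module Defs where

open import Data.Nat using (ℕ; _^_; _∸_) renaming (_≤_ to _≤ℕ_)
open import Data.Integer using (ℤ; +_; _*_; _≤_)
open import Data.Integer.Properties using (≤-totalOrder; _≟_)
open import Data.List using (List; []; _∷_; _∷ʳ_; foldr; filter; length)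
open import Data.List.Relation.Unary.Sorted.TotalOrder ≤-totalOrder using (Sorted)
open import Data.Product using (Σ; ∃; ∃-syntax; _×_)
open import Relation.Binary.PropositionalEquality using (_≡_)

productℤ : List ℤ → ℤ
productℤ = foldr _*_ (+ 1)

occ : ℤ → List ℤ → ℕ
occ x xs = length (filter (x ≟_) xs)

IsProductSeq : ℕ → List ℤ → Set
IsProductSeq m xs =
  Sorted xs
  × (∃[ R ] productℤ xs ≡ + (R ^ m))
  × (∀ x → occ x xs ≤ℕ m ∸ 1)

SeqFromTo : ℕ → ℕ → ℤ → List ℤ → Set
SeqFromTo m n s xs =
  IsProductSeq m xs
  × (∃[ ys ] xs ≡ (+ n) ∷ ys)
  × (∃[ zs ] xs ≡ zs ∷ʳ s)

-- IsG m n s  :  s = g_m(n), the least s for which such a sequence exists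
IsG : ℕ → ℕ → ℤ → Set
IsG m n s =
  (∃[ xs ] SeqFromTo m n s xs)
  × (∀ s′ xs → SeqFromTo m n s′ xs → s ≤ s′)

-- If n ≢ 4, the sequence n, 6k, 8k, 9k, 2n, 2n has product (12nk)³ and at most two copies of
-- each value as soon as n ≤ 6k and 9k < 2n; such a k exists for n ≥ 16 and for most smaller n,
-- and the remaining small n are cubes or have a short explicit sequence.  If n = 4, a sequence
-- ending at most at 8 lives in {4,…,8} and, the product depending only on the multiplicities,
-- equals 4^c₄ 5^c₅ 6^c₆ 7^c₇ 8^c₈ with 1 ≤ c₄ ≤ 2 and all cᵢ ≤ 2; none of these 162 numbers is a cube.
module Submission where

open import Defs
open import Data.Nat using (ℕ)
open import Data.Integer using (ℤ; +_; _≤_)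
open import Relation.Binary.PropositionalEquality using (_≢_)
open import Function.Bundles using (_⇔_)

open import Data.Bool using (Bool; T; if_then_else_; _∧_)
open import Data.Bool.Properties using (T-∧)
open import Data.Empty using (⊥-elim)
open import Data.Integer as ℤ using (_<_; ∣_∣; +≤+; +<+)
import Data.Integer.Properties as ℤₚ
open import Algebra.Properties.CommutativeSemigroup ℤₚ.*-commutativeSemigroup using (x∙yz≈y∙xz)
import Data.List as List
open import Data.List using (List; []; _∷_; _∷ʳ_; map; applyUpTo; upTo)
open import Data.List.Membership.Propositional using (_∈_)
open import Data.List.Membership.Propositional.Properties using (∈-map⁺; ∈-applyUpTo⁺; ∈-upTo⁺)
open import Data.List.Properties using (filter-accept; filter-reject; filter-none)
open import Data.List.Relation.Unary.All as All using (All; []; _∷_; all?)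
open import Data.List.Relation.Unary.All.Properties using (∷ʳ⁺; ∷ʳ⁻)
open import Data.List.Relation.Unary.AllPairs using (AllPairs; []; _∷_)
open import Data.List.Relation.Unary.Any using (here; there)
open import Data.List.Relation.Unary.Linked as Linked using ([]; [-]; _∷_)
open import Data.List.Relation.Unary.Sorted.TotalOrder ℤₚ.≤-totalOrder using (Sorted; sorted?)
open import Data.List.Relation.Unary.Sorted.TotalOrder.Properties using (Sorted⇒AllPairs)
open import Data.List.Relation.Unary.Unique.Propositional using (Unique)
open import Data.List.Relation.Unary.Unique.DecPropositional ℤ._≟_ using (unique?)
open import Data.Nat as ℕ using (zero; suc; z≤n; s≤s; _+_; _*_; _^_; _<ᵇ_)
import Data.Nat.Properties as ℕₚ
open import Data.Nat.DivMod using (_/_; _%_; m/n*n≤m; m≡m%n+[m/n]*n; m%n<n)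
open import Data.Nat.ListAction using (product)
open import Data.Nat.Tactic.RingSolver using (solve-∀; solve)
open import Data.Product using (∃-syntax; ∃₂; _×_; _,_; proj₂; uncurry)
open import Function.Bundles using (mk⇔; Equivalence)
open import Relation.Binary.PropositionalEquality
  using (_≡_; refl; sym; trans; cong; cong₂; subst; ≢-sym; module ≡-Reasoning)
open import Relation.Nullary using (Dec; yes; no)
open import Relation.Nullary.Decidable using (True; from-yes; toWitness; T?; _×-dec_)
import Relation.Nullary.Decidable as Dec

occ-here : ∀ x xs → occ x (x ∷ xs) ≡ suc (occ x xs)
occ-here x xs = cong Data.List.length (filter-accept (x ℤ.≟_) refl)

occ-there : ∀ {x y} xs → x ≢ y → occ x (y ∷ xs) ≡ occ x xs
occ-there {x} xs x≢y = cong Data.List.length (filter-reject (x ℤ.≟_) x≢y)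

occ-absent : ∀ {x xs} → All (x ≢_) xs → occ x xs ≡ 0
occ-absent {x} x∉xs = cong Data.List.length (filter-none (x ℤ.≟_) x∉xs)

occ-∷-≤ : ∀ x y xs → occ x (y ∷ xs) ℕ.≤ suc (occ x xs)
occ-∷-≤ x y xs with x ℤ.≟ y
... | yes _ = ℕₚ.≤-refl
... | no  _ = ℕₚ.n≤1+n _

-- x₁ < x₃, x₂ < x₄, … : in a sorted list this says that no value occurs three times.
data Increasing₂ : List ℤ → Set where
  []    : Increasing₂ []
  [-]   : ∀ {x} → Increasing₂ (x ∷ [])
  [-,-] : ∀ {x y} → Increasing₂ (x ∷ y ∷ [])
  _∷_   : ∀ {x y z zs} → x < z → Increasing₂ (y ∷ z ∷ zs) → Increasing₂ (x ∷ y ∷ z ∷ zs)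

increasing₂? : ∀ xs → Dec (Increasing₂ xs)
increasing₂? []               = yes []
increasing₂? (x ∷ [])         = yes [-]
increasing₂? (x ∷ y ∷ [])     = yes [-,-]
increasing₂? (x ∷ y ∷ z ∷ zs) =
  Dec.map′ (uncurry _∷_) (λ { (x<z ∷ inc) → x<z , inc }) (x ℤ.<? z ×-dec increasing₂? (y ∷ z ∷ zs))

Increasing₂⇒occ≤2 : ∀ {xs} → Sorted xs → Increasing₂ xs → ∀ x → occ x xs ℕ.≤ 2
Increasing₂⇒occ≤2 _ [] x = z≤n
Increasing₂⇒occ≤2 _ [-] x = ℕₚ.≤-trans (occ-∷-≤ x _ []) (s≤s z≤n)
Increasing₂⇒occ≤2 _ [-,-] x = ℕₚ.≤-trans (occ-∷-≤ x _ (_ ∷ [])) (s≤s (occ-∷-≤ x _ []))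
Increasing₂⇒occ≤2 {a ∷ b ∷ c ∷ zs} sorted (a<c ∷ inc) x with x ℤ.≟ a
... | yes refl = s≤s (ℕₚ.≤-trans (occ-∷-≤ a b (c ∷ zs)) (s≤s (ℕₚ.≤-reflexive (occ-absent a∉c∷zs))))
  where
  a∉c∷zs : All (a ≢_) (c ∷ zs)
  a∉c∷zs with c≤zs ∷ _ ← Sorted⇒AllPairs ℤₚ.≤-totalOrder (Linked.tail (Linked.tail sorted)) =
    ℤₚ.<⇒≢ a<c ∷ All.map (λ c≤z → ℤₚ.<⇒≢ (ℤₚ.<-≤-trans a<c c≤z)) c≤zs
... | no _ = Increasing₂⇒occ≤2 (Linked.tail sorted) inc x

ShortSequence : ℕ → Set
ShortSequence n = ∃₂ λ s xs → SeqFromTo 3 n s xs × s ≤ + (2 * n)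

short-sequence-from : ∀ {n s} ms R → Sorted (+ n ∷ ms ∷ʳ s) → Increasing₂ (+ n ∷ ms ∷ʳ s) →
                      productℤ (+ n ∷ ms ∷ʳ s) ≡ + (R ^ 3) → s ≤ + (2 * n) → ShortSequence n
short-sequence-from {n} ms R sorted inc cube s≤2n =
  _ , _ , ((sorted , (R , cube) , Increasing₂⇒occ≤2 sorted inc) , (_ , refl) , (+ n ∷ ms , refl)) , s≤2n

decided-short-sequence : ∀ {n} ms s R → let xs = + n ∷ ms ∷ʳ + s in
                         {True (sorted? ℤ._≤?_ xs)} → {True (increasing₂? xs)} →
                         productℤ xs ≡ + (R ^ 3) → {True (+ s ℤ.≤? + (2 * n))} → ShortSequence n
decided-short-sequence ms s R {sorted} {inc} cube {s≤2n} =
  short-sequence-from ms R (toWitness sorted) (toWitness inc) cube (toWitness s≤2n)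

cube-short-sequence : ∀ R → ShortSequence (R ^ 3)
cube-short-sequence R =
  _ , _ , (([-] , (R , ℤₚ.*-identityʳ _) , Increasing₂⇒occ≤2 [-] [-]) , (_ , refl) , ([] , refl)) ,
  +≤+ (ℕₚ.m≤m+n (R ^ 3) _)

productℤ-map-+ : ∀ ns → productℤ (map +_ ns) ≡ + product ns
productℤ-map-+ []       = refl
productℤ-map-+ (n ∷ ns) = trans (cong (+ n ℤ.*_) (productℤ-map-+ ns)) (sym (ℤₚ.pos-* n (product ns)))

family-product : ∀ n k → n * (6 * k * (8 * k * (9 * k * (2 * n * (2 * n * 1))))) ≡ (12 * n * k) ^ 3
family-product = expanded
  where
  -- the ring solver does not interpret _^_, so the cube is spelled out
  expanded : ∀ n k → n * (6 * k * (8 * k * (9 * k * (2 * n * (2 * n * 1))))) ≡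
                       12 * n * k * (12 * n * k * (12 * n * k * 1))
  expanded = solve-∀

family-short-sequence : ∀ n k → n ℕ.≤ 6 * k → 9 * k ℕ.< 2 * n → ShortSequence n
family-short-sequence zero zero z≤n ()
family-short-sequence n k@(suc _) n≤6k 9k<2n =
  short-sequence-from (+ (6 * k) ∷ + (8 * k) ∷ + (9 * k) ∷ + (2 * n) ∷ []) (12 * n * k)
    (+≤+ n≤6k ∷ +≤+ (ℕₚ.<⇒≤ 6k<8k) ∷ +≤+ (ℕₚ.<⇒≤ 8k<9k) ∷ +≤+ (ℕₚ.<⇒≤ 9k<2n) ∷ ℤₚ.≤-refl ∷ [-])
    (+<+ (ℕₚ.≤-<-trans n≤6k 6k<8k) ∷ +<+ (ℕₚ.<-trans 6k<8k 8k<9k) ∷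
     +<+ (ℕₚ.<-trans 8k<9k 9k<2n) ∷ +<+ 9k<2n ∷ [-,-])
    (trans (productℤ-map-+ (n ∷ 6 * k ∷ 8 * k ∷ 9 * k ∷ 2 * n ∷ 2 * n ∷ [])) (cong +_ (family-product n k)))
    ℤₚ.≤-refl
  where
  6k<8k : 6 * k ℕ.< 8 * k
  6k<8k = ℕₚ.*-monoˡ-< k (ℕₚ.≤ᵇ⇒≤ 7 8 _)
  8k<9k : 8 * k ℕ.< 9 * k
  8k<9k = ℕₚ.*-monoˡ-< k (ℕₚ.n<1+n 8)

⌈_/6⌉-bounds : ∀ n → ∃[ k ] n ℕ.≤ 6 * k × 6 * k ℕ.≤ n + 5
⌈ n /6⌉-bounds = k , n≤6k , 6k≤n+5
  where
  open ℕₚ.≤-Reasoning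
  k = (n + 5) / 6
  6k≤n+5 : 6 * k ℕ.≤ n + 5
  6k≤n+5 = subst (ℕ._≤ n + 5) (ℕₚ.*-comm k 6) (m/n*n≤m (n + 5) 6)
  n≤6k : n ℕ.≤ 6 * k
  n≤6k = ℕₚ.+-cancelʳ-≤ 5 n (6 * k) (begin
    n + 5               ≡⟨ m≡m%n+[m/n]*n (n + 5) 6 ⟩
    (n + 5) % 6 + k * 6 ≤⟨ ℕₚ.+-monoˡ-≤ (k * 6) (ℕₚ.≤-pred (m%n<n (n + 5) 6)) ⟩
    5 + k * 6           ≡⟨ ℕₚ.+-comm 5 (k * 6) ⟩
    k * 6 + 5           ≡⟨ cong (_+ 5) (ℕₚ.*-comm k 6) ⟩
    6 * k + 5           ∎)

6k≤n+5⇒9k<2n : ∀ {n k} → 16 ℕ.≤ n → 6 * k ℕ.≤ n + 5 → 9 * k ℕ.< 2 * n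
6k≤n+5⇒9k<2n {n} {k} 16≤n 6k≤n+5 = ℕₚ.*-cancelˡ-< 2 (9 * k) (2 * n) (begin-strict
  2 * (9 * k)    ≡⟨ solve (k List.∷ List.[]) ⟩
  3 * (6 * k)    ≤⟨ ℕₚ.*-monoʳ-≤ 3 6k≤n+5 ⟩
  3 * (n + 5)    ≡⟨ ℕₚ.*-distribˡ-+ 3 n 5 ⟩
  3 * n + 15     <⟨ ℕₚ.+-monoʳ-< (3 * n) 16≤n ⟩
  3 * n + n      ≡⟨ solve (n List.∷ List.[]) ⟩
  2 * (2 * n)    ∎)
  where open ℕₚ.≤-Reasoning

≥16⇒short-sequence : ∀ {n} → 16 ℕ.≤ n → ShortSequence n
≥16⇒short-sequence {n} 16≤n =
  let k , n≤6k , 6k≤n+5 = ⌈ n /6⌉-bounds in family-short-sequence n k n≤6k (6k≤n+5⇒9k<2n {k = k} 16≤n 6k≤n+5)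

≢4⇒short-sequence : ∀ n → n ≢ 4 → ShortSequence n
≢4⇒short-sequence 0  _ = cube-short-sequence 0
≢4⇒short-sequence 1  _ = cube-short-sequence 1
≢4⇒short-sequence 2  _ = decided-short-sequence [] 4 2 refl
≢4⇒short-sequence 3  _ = decided-short-sequence (+ 4 ∷ + 4 ∷ + 6 ∷ []) 6 12 refl
≢4⇒short-sequence 4  n≢4 = ⊥-elim (n≢4 refl)
≢4⇒short-sequence 5  _ = family-short-sequence 5 1 (ℕₚ.≤ᵇ⇒≤ _ _ _) (ℕₚ.≤ᵇ⇒≤ _ _ _)
≢4⇒short-sequence 6  _ = family-short-sequence 6 1 (ℕₚ.≤ᵇ⇒≤ _ _ _) (ℕₚ.≤ᵇ⇒≤ _ _ _)
≢4⇒short-sequence 7  _ = decided-short-sequence (+ 9 ∷ + 9 ∷ + 12 ∷ + 12 ∷ + 14 ∷ []) 14 252 refl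
≢4⇒short-sequence 8  _ = cube-short-sequence 2
≢4⇒short-sequence 9  _ = decided-short-sequence (+ 12 ∷ []) 16 12 refl
≢4⇒short-sequence 10 _ = family-short-sequence 10 2 (ℕₚ.≤ᵇ⇒≤ _ _ _) (ℕₚ.≤ᵇ⇒≤ _ _ _)
≢4⇒short-sequence 11 _ = family-short-sequence 11 2 (ℕₚ.≤ᵇ⇒≤ _ _ _) (ℕₚ.≤ᵇ⇒≤ _ _ _)
≢4⇒short-sequence 12 _ = family-short-sequence 12 2 (ℕₚ.≤ᵇ⇒≤ _ _ _) (ℕₚ.≤ᵇ⇒≤ _ _ _)
≢4⇒short-sequence 13 _ = decided-short-sequence (+ 20 ∷ + 20 ∷ + 25 ∷ + 25 ∷ + 26 ∷ []) 26 1300 refl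
≢4⇒short-sequence 14 _ = family-short-sequence 14 3 (ℕₚ.≤ᵇ⇒≤ _ _ _) (ℕₚ.≤ᵇ⇒≤ _ _ _)
≢4⇒short-sequence 15 _ = family-short-sequence 15 3 (ℕₚ.≤ᵇ⇒≤ _ _ _) (ℕₚ.≤ᵇ⇒≤ _ _ _)
≢4⇒short-sequence (suc (suc (suc (suc (suc (suc (suc (suc (suc (suc (suc (suc (suc (suc (suc (suc m)))))))))))))))) _ =
  ≥16⇒short-sequence (ℕₚ.m≤m+n 16 m)

powerProduct : List ℤ → List ℤ → ℤ
powerProduct vs xs = productℤ (map (λ v → v ℤ.^ occ v xs) vs)

powerProduct-[] : ∀ vs → powerProduct vs [] ≡ + 1
powerProduct-[] []       = refl
powerProduct-[] (v ∷ vs) = trans (ℤₚ.*-identityˡ _) (powerProduct-[] vs)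

powerProduct-∉ : ∀ {x} xs vs → All (_≢ x) vs → powerProduct vs (x ∷ xs) ≡ powerProduct vs xs
powerProduct-∉ xs []       []             = refl
powerProduct-∉ xs (v ∷ vs) (v≢x ∷ vs≢x) =
  cong₂ ℤ._*_ (cong (v ℤ.^_) (occ-there xs v≢x)) (powerProduct-∉ xs vs vs≢x)

powerProduct-∷ : ∀ {x vs} xs → Unique vs → x ∈ vs → powerProduct vs (x ∷ xs) ≡ x ℤ.* powerProduct vs xs
powerProduct-∷ {x} {_ ∷ vs} xs (x∉vs ∷ _) (here refl) = begin
  x ℤ.^ occ x (x ∷ xs) ℤ.* powerProduct vs (x ∷ xs)
    ≡⟨ cong₂ ℤ._*_ (cong (x ℤ.^_) (occ-here x xs)) (powerProduct-∉ xs vs (All.map ≢-sym x∉vs)) ⟩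
  x ℤ.* x ℤ.^ occ x xs ℤ.* powerProduct vs xs
    ≡⟨ ℤₚ.*-assoc x _ _ ⟩
  x ℤ.* (x ℤ.^ occ x xs ℤ.* powerProduct vs xs) ∎
  where open ≡-Reasoning
powerProduct-∷ {x} {v ∷ vs} xs (v∉vs ∷ unique) (there x∈vs) = begin
  v ℤ.^ occ v (x ∷ xs) ℤ.* powerProduct vs (x ∷ xs)
    ≡⟨ cong₂ ℤ._*_ (cong (v ℤ.^_) (occ-there xs (All.lookup v∉vs x∈vs))) (powerProduct-∷ xs unique x∈vs) ⟩
  v ℤ.^ occ v xs ℤ.* (x ℤ.* powerProduct vs xs)
    ≡⟨ x∙yz≈y∙xz (v ℤ.^ occ v xs) x (powerProduct vs xs) ⟩
  x ℤ.* (v ℤ.^ occ v xs ℤ.* powerProduct vs xs) ∎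
  where open ≡-Reasoning

productℤ≡powerProduct : ∀ {vs} xs → Unique vs → All (_∈ vs) xs → productℤ xs ≡ powerProduct vs xs
productℤ≡powerProduct {vs} []       _      []            = sym (powerProduct-[] vs)
productℤ≡powerProduct {vs} (x ∷ xs) unique (x∈vs ∷ xs∈vs) = begin
  x ℤ.* productℤ xs         ≡⟨ cong (x ℤ.*_) (productℤ≡powerProduct xs unique xs∈vs) ⟩
  x ℤ.* powerProduct vs xs  ≡⟨ powerProduct-∷ xs unique x∈vs ⟨
  powerProduct vs (x ∷ xs) ∎
  where open ≡-Reasoning

interval : ℕ → ℕ → List ℤ
interval a k = map +_ (applyUpTo (a ℕ.+_) (suc k))

∈-interval : ∀ {a k x} → + a ≤ x → x ≤ + (a + k) → x ∈ interval a k
∈-interval {a} {k} (+≤+ {n = n} a≤n) (+≤+ n≤a+k) =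
  ∈-map⁺ +_ (subst (_∈ applyUpTo (a ℕ.+_) (suc k)) (ℕₚ.m+[n∸m]≡n a≤n)
    (∈-applyUpTo⁺ (a ℕ.+_) (s≤s (subst (n ℕ.∸ a ℕ.≤_) (ℕₚ.m+n∸m≡n a k) (ℕₚ.∸-monoˡ-≤ a n≤a+k)))))

AllPairs-∷ʳ⇒All : ∀ {A : Set} {R : A → A → Set} {s} zs → AllPairs R (zs ∷ʳ s) → All (λ z → R z s) zs
AllPairs-∷ʳ⇒All []       _          = []
AllPairs-∷ʳ⇒All (z ∷ zs) (Rz ∷ Rzs) = proj₂ (∷ʳ⁻ Rz) ∷ AllPairs-∷ʳ⇒All zs Rzs

between-powers⇒≢^ : ∀ m {r p} → r ^ m ℕ.< p → p ℕ.< suc r ^ m → ∀ R → p ≢ R ^ m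
between-powers⇒≢^ m {r} r^m<p p<[1+r]^m R refl with R ℕ.≤? r
... | yes R≤r = ℕₚ.<⇒≱ r^m<p (ℕₚ.^-monoˡ-≤ m R≤r)
... | no  R≰r = ℕₚ.<-irrefl refl (ℕₚ.<-≤-trans p<[1+r]^m (ℕₚ.^-monoˡ-≤ m (ℕₚ.≰⇒> R≰r)))

⌊∛_⌋ : ℕ → ℕ
⌊∛ p ⌋ = search p 0
  where
  search : ℕ → ℕ → ℕ
  search zero       r = r
  search (suc fuel) r = if p <ᵇ suc r ^ 3 then r else search fuel (suc r)

-- The test certifies its own answer: nothing about ⌊∛_⌋ is ever proved or needed.
strictlyBetweenCubes : ℕ → Bool
strictlyBetweenCubes p = (⌊∛ p ⌋ ^ 3 <ᵇ p) ∧ (p <ᵇ suc ⌊∛ p ⌋ ^ 3)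

strictlyBetweenCubes⇒≢³ : ∀ p → T (strictlyBetweenCubes p) → ∀ R → p ≢ R ^ 3
strictlyBetweenCubes⇒≢³ p between =
  let below , above = Equivalence.to T-∧ between
  in between-powers⇒≢^ 3 {⌊∛ p ⌋} (ℕₚ.<ᵇ⇒< _ _ below) (ℕₚ.<ᵇ⇒< _ _ above)

powers-of-4…8 : ℕ → ℕ → ℕ → ℕ → ℕ → ℕ
powers-of-4…8 c₄ c₅ c₆ c₇ c₈ = ∣ productℤ ((+ 4) ℤ.^ c₄ ∷ (+ 5) ℤ.^ c₅ ∷ (+ 6) ℤ.^ c₆ ∷ (+ 7) ℤ.^ c₇ ∷ (+ 8) ℤ.^ c₈ ∷ []) ∣

cube-free-powers-of-4…8 :
  All (λ c₄ → All (λ c₅ → All (λ c₆ → All (λ c₇ → All (λ c₈ →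
    T (strictlyBetweenCubes (powers-of-4…8 (suc c₄) c₅ c₆ c₇ c₈)))
    (upTo 3)) (upTo 3)) (upTo 3)) (upTo 3)) (upTo 2)
cube-free-powers-of-4…8 = from-yes (all? (λ c₄ → all? (λ c₅ → all? (λ c₆ → all? (λ c₇ → all? (λ c₈ →
  T? (strictlyBetweenCubes (powers-of-4…8 (suc c₄) c₅ c₆ c₇ c₈)))
  (upTo 3)) (upTo 3)) (upTo 3)) (upTo 3)) (upTo 2))

short-sequence⇒≢4 : ∀ {n s xs} → SeqFromTo 3 n s xs → s ≤ + (2 * n) → n ≢ 4
short-sequence⇒≢4 {s = s} ((sorted , (R , cube) , occ≤2) , (ys , refl) , (zs , xs≡zs∷ʳs)) s≤8 refl =
  strictlyBetweenCubes⇒≢³ _ between R (cong ∣_∣ (trans (sym xs≡powerProduct) cube))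
  where
  xs = + 4 ∷ ys
  above-4 : All (+ 4 ≤_) xs
  above-4 with 4≤ys ∷ _ ← Sorted⇒AllPairs ℤₚ.≤-totalOrder sorted = ℤₚ.≤-refl ∷ 4≤ys
  below-s : All (_≤ s) xs
  below-s = subst (All (_≤ s)) (sym xs≡zs∷ʳs) (∷ʳ⁺ (AllPairs-∷ʳ⇒All zs sorted′) ℤₚ.≤-refl)
    where sorted′ = subst (AllPairs _≤_) xs≡zs∷ʳs (Sorted⇒AllPairs ℤₚ.≤-totalOrder sorted)
  xs≡powerProduct : productℤ xs ≡ powerProduct (interval 4 4) xs
  xs≡powerProduct = productℤ≡powerProduct xs (from-yes (unique? (interval 4 4)))
    (All.zipWith (λ (4≤x , x≤s) → ∈-interval 4≤x (ℤₚ.≤-trans x≤s s≤8)) (above-4 , below-s))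
  count : ∀ v → occ v xs ∈ upTo 3
  count v = ∈-upTo⁺ (s≤s (occ≤2 v))
  between : T (strictlyBetweenCubes ∣ powerProduct (interval 4 4) xs ∣)
  between = All.lookup (All.lookup (All.lookup (All.lookup (All.lookup cube-free-powers-of-4…8
    (∈-upTo⁺ (occ≤2 (+ 4)))) (count (+ 5))) (count (+ 6))) (count (+ 7))) (count (+ 8))

lemma4p6 : (n : ℕ) (g : ℤ) → IsG 3 n g → (g ≤ + (2 Data.Nat.* n) ⇔ n ≢ 4)
lemma4p6 n g ((_ , sequence) , minimal) = mk⇔ (short-sequence⇒≢4 sequence) λ n≢4 →
  let s , xs , short , s≤2n = ≢4⇒short-sequence n n≢4 in ℤₚ.≤-trans (minimal s xs short) s≤2n
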